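{- Let $n\ge 2$ be even and $0\le j\le n$. Then \[ \mathrm{Orb}(C_n,\mathrm{Neck}(n,j))_1^{f}\cap \mathrm{Orb}(C_n,\mathrm{Neck}(n,j))_2^{f} = \mathrm{Orb}_{odd}(C_n,\mathrm{Neck}(n,j))^{f}. \] In other words, $\mathrm{Orb}_{even}(C_n,\mathrm{Neck}(n,j))_1^{f}\cap \mathrm{Orb}_{even}(C_n,\mathrm{Neck}(n,j))_2^{f}=\emptyset$.
   Context: Place $n$ beads at the points $P_m=R^m(0,1)\in\mathbb R^2$, $m\in\mathbb Z/n$, $R$ the counterclockwise rotation by $2\pi/n$. $\mathrm{Neck}(n,j)$ is the set of colorings of these positions with $j$ blue and $n-j$ red beads. $C_n$ acts by rotation ($P_m\mapsto P_{m+1}$) and the flip $f$ by reflection in the vertical axis ($P_m\mapsto P_{ -m}$); $f$ acts on the set $\mathrm{Orb}(C_n,\mathrm{Neck}(n,j))$ of rotation orbits, and a superscript $f$ denotes the subset of $f$-fixed orbits. Subscripts $even$/$odd$ denote the subsets of orbits of even/odd cardinality. A line $\sigma$ through the origin is a symmetry axis of a necklace $l$ if reflection in $\sigma$ preserves the set of blue positions of $l$. For $i=1,2$, $\mathrm{Orb}(C_n,\mathrm{Neck}(n,j))^f_i$ is the set of $f$-fixed orbits $[l]$ having a representative $l$ with a symmetry axis of type $i$, where a symmetry axis is of type 1 if it contains none of the points $P_m$, and of type 2 if it contains at least one of them. The same subscript conventions apply to $\mathrm{Orb}_{even}$ and $\mathrm{Orb}_{odd}$. -}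

module Defs where

open import Data.Bool using (Bool; true; false; _≟_)
open import Data.Nat using (ℕ; zero; suc; _+_; _∸_; _%_; NonZero)
open import Data.Nat.DivMod using (m%n<n)
open import Data.Fin using (Fin; toℕ; fromℕ<)
open import Data.Vec using (Vec; []; _∷_; lookup; tabulate; toList)
open import Data.Vec.Properties using (≡-dec)
open import Data.List using (List; length; deduplicate)
open import Data.Product using (Σ; _×_; ∃)
open import Relation.Binary.PropositionalEquality using (_≡_)
open import Relation.Nullary using (¬_)

-- A coloring of the n positions P_0,…,P_{n-1}: true = blue, false = red.
Coloring : ℕ → Set
Coloring n = Vec Bool n

blues : ∀ {n} → Coloring n → ℕ
blues []           = 0
blues (true  ∷ xs) = suc (blues xs)
blues (false ∷ xs) = blues xs

InNeck : ∀ {n} → ℕ → Coloring n → Set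
InNeck j l = blues l ≡ j

idx : (n : ℕ) → .{{_ : NonZero n}} → ℕ → Fin n
idx n m = fromℕ< (m%n<n m n)

-- rotation by r steps: P_m ↦ P_{m+r}, so (rot r l)(m) = l(m - r mod n)
rot : ∀ {n} .{{_ : NonZero n}} → ℕ → Coloring n → Coloring n
rot {n} r l = tabulate (λ m → lookup l (idx n (toℕ m + (n ∸ (r % n)))))

-- reflection s_k : P_m ↦ P_{k-m}; (refl k l)(m) = l(k - m mod n).
-- s_0 is the flip f (reflection in the vertical axis).
reflect : ∀ {n} .{{_ : NonZero n}} → Fin n → Coloring n → Coloring n
reflect {n} k l = tabulate (λ m → lookup l (idx n (toℕ k + (n ∸ toℕ m))))

flip : ∀ {n} .{{_ : NonZero n}} → Coloring n → Coloring n
flip {n} l = tabulate (λ m → lookup l (idx n (n ∸ toℕ m)))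

SameOrbit : ∀ {n} .{{_ : NonZero n}} → Coloring n → Coloring n → Set
SameOrbit {n} l l' = Σ (Fin n) λ r → rot (toℕ r) l ≡ l'

FlipFixedOrbit : ∀ {n} .{{_ : NonZero n}} → Coloring n → Set
FlipFixedOrbit l = SameOrbit l (flip l)

-- the axis of s_k contains the point P_m  (i.e. s_k fixes P_m)
OnAxis : ∀ {n} .{{_ : NonZero n}} → Fin n → Fin n → Set
OnAxis {n} k m = idx n (toℕ k + (n ∸ toℕ m)) ≡ m

AxisType2 : ∀ {n} .{{_ : NonZero n}} → Fin n → Set
AxisType2 {n} k = ∃ λ (m : Fin n) → OnAxis k m

AxisType1 : ∀ {n} .{{_ : NonZero n}} → Fin n → Set
AxisType1 k = ¬ AxisType2 k

IsSymAxis : ∀ {n} .{{_ : NonZero n}} → Fin n → Coloring n → Set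
IsSymAxis k l = reflect k l ≡ l

HasRepWithAxis1 : ∀ {n} .{{_ : NonZero n}} → Coloring n → Set
HasRepWithAxis1 {n} l =
  Σ (Coloring n) λ l' → SameOrbit l l' × (Σ (Fin n) λ k → IsSymAxis k l' × AxisType1 k)

HasRepWithAxis2 : ∀ {n} .{{_ : NonZero n}} → Coloring n → Set
HasRepWithAxis2 {n} l =
  Σ (Coloring n) λ l' → SameOrbit l l' × (Σ (Fin n) λ k → IsSymAxis k l' × AxisType2 k)

orbitSize : ∀ {n} .{{_ : NonZero n}} → Coloring n → ℕ
orbitSize {n} l =
  length (deduplicate (≡-dec _≟_) (toList (tabulate {n = n} (λ r → rot (toℕ r) l))))

OddOrbit : ∀ {n} .{{_ : NonZero n}} → Coloring n → Set
OddOrbit l = orbitSize l % 2 ≡ 1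

{-# OPTIONS --safe #-}

-- Read a colouring as an n-periodic function on ℕ. The reflection s_k : P_a ↦ P_{k-a}
-- fixes P_m iff k ≡ 2m (mod n), so for even n its axis is of type 2 exactly when k is
-- even. A symmetry s_k of the rotated necklace R^r l is a symmetry s_{k-2r} of l, hence
-- the parities of the symmetries only depend on the orbit. Two symmetries s_{k₁}, s_{k₂}
-- of l make k₁ - k₂ a period of l, and a symmetry s_k with a period t gives the symmetry
-- s_{k+t}. As an f-fixed orbit has a symmetric representative, it has axes of both types
-- iff l has an odd period. Finally the orbit size is the minimal period of l, which
-- divides every period, so l has an odd period iff its orbit is odd.

module Submission where

open import Defs

open import Data.Bool using (Bool)
import Data.Bool as Bool
open import Data.Fin using (Fin; toℕ; fromℕ<)
import Data.Fin as Fin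
open import Data.Fin.Properties using (toℕ-fromℕ<; toℕ-injective; toℕ<n; all?)
open import Data.List using (List; length; deduplicate)
import Data.List as List
open import Data.List.Membership.Propositional using (_∈_)
open import Data.List.Membership.Propositional.Properties using (∈-tabulate⁺; ∈-tabulate⁻; deduplicate-∈⇔)
open import Data.List.Membership.Propositional.Properties.WithK using (unique∧set⇒bag)
open import Data.List.Properties using (length-tabulate)
open import Data.List.Relation.Binary.BagAndSetEquality using (∼bag⇒↭)
open import Data.List.Relation.Binary.Permutation.Propositional.Properties using (↭-length)
open import Data.List.Relation.Unary.Unique.DecPropositional.Properties using (deduplicate-!)
open import Data.List.Relation.Unary.Unique.Propositional using (Unique)
open import Data.List.Relation.Unary.Unique.Propositional.Properties using (tabulate⁺)
open import Data.Nat using (ℕ; zero; suc; pred; _+_; _*_; _∸_; _%_; _/_; _≤_; _<_; s<s; NonZero; >-nonZero⁻¹)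
open import Data.Nat.DivMod
open import Data.Nat.Divisibility using (_∣_; divides; m%n≡0⇒n∣m; n∣m⇒m%n≡0; ∣-trans)
open import Data.Nat.Properties
open import Algebra.Properties.CommutativeSemigroup +-commutativeSemigroup
  using (interchange; xy∙z≈x∙zy; xy∙z≈xz∙y; xy∙z≈y∙xz)
open import Data.Product using (∃; _×_; _,_; proj₁; proj₂)
import Data.Product as Product
open import Data.Sum using (_⊎_; inj₁; inj₂)
open import Data.Vec using (lookup; tabulate; toList)
open import Data.Vec.Properties using (lookup∘tabulate; ≡-dec)
open import Data.Vec.Relation.Binary.Pointwise.Extensional using (ext; Pointwise-≡⇒≡)
open import Function using (_∘_; _on_)
open import Function.Bundles using (_⇔_; mk⇔; Equivalence)
open import Function.Properties.Equivalence using () renaming (trans to ⇔-trans)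
open import Relation.Binary using (Setoid; DecidableEquality; tri<; tri≈; tri>)
import Relation.Binary.Construct.On as On
open import Relation.Binary.PropositionalEquality
import Relation.Binary.Reasoning.Setoid as ≈-Reasoning
open import Relation.Nullary using (¬_; yes; no; contradiction)
open import Relation.Unary using (Decidable)

open Equivalence using (to; from)

toList-tabulate : ∀ {a} {A : Set a} {m} (f : Fin m → A) → toList (tabulate f) ≡ List.tabulate f
toList-tabulate {m = zero}  f = refl
toList-tabulate {m = suc m} f = cong (f Fin.zero List.∷_) (toList-tabulate (f ∘ Fin.suc))

length-deduplicate : ∀ {a} {A : Set a} (_≟_ : DecidableEquality A) {xs ys : List A} →
  Unique ys → (∀ {x} → x ∈ xs ⇔ x ∈ ys) → length (deduplicate _≟_ xs) ≡ length ys
length-deduplicate _≟_ {xs} ys! xs≈ys = ↭-length (∼bag⇒↭ (unique∧set⇒bag (deduplicate-! _≟_ xs) ys!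
  (mk⇔ (to xs≈ys ∘ from (deduplicate-∈⇔ _≟_)) (to (deduplicate-∈⇔ _≟_) ∘ from xs≈ys))))

least-witness : ∀ {p} {P : ℕ → Set p} → Decidable P → ∀ w → P w →
  ∃ λ d → P d × (∀ {m} → m < d → ¬ P m)
least-witness P? zero    pw = zero , pw , λ ()
least-witness P? (suc w) pw with P? zero
... | yes p₀ = zero , p₀ , λ ()
... | no ¬p₀ with least-witness (P? ∘ suc) w pw
...   | d , pd , below = suc d , pd , λ { {zero} _ → ¬p₀ ; {suc m} (s<s m<d) → below m<d }

%2-dichotomy : ∀ m → m % 2 ≡ 0 ⊎ m % 2 ≡ 1
%2-dichotomy m with m % 2 | m%n<n m 2
... | 0           | _            = inj₁ refl
... | 1           | _            = inj₂ refl
... | suc (suc _) | s<s (s<s ())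

m*2≡m+m : ∀ m → m * 2 ≡ m + m
m*2≡m+m m = trans (*-comm m 2) (cong (m +_) (+-identityʳ m))

[m+m]%2≡0 : ∀ m → (m + m) % 2 ≡ 0
[m+m]%2≡0 m = n∣m⇒m%n≡0 (m + m) 2 (divides m (sym (m*2≡m+m m)))

odd+odd%2≡0 : ∀ a b → a % 2 ≡ 1 → b % 2 ≡ 1 → (a + b) % 2 ≡ 0
odd+odd%2≡0 a b a-odd b-odd = trans (%-distribˡ-+ a b 2) (cong₂ (λ u v → (u + v) % 2) a-odd b-odd)

∣odd⇒odd : ∀ {d t} → d ∣ t → t % 2 ≡ 1 → d % 2 ≡ 1
∣odd⇒odd {d} {t} d∣t t-odd with %2-dichotomy d
... | inj₂ d-odd  = d-odd
... | inj₁ d-even =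
  contradiction (trans (sym (n∣m⇒m%n≡0 t 2 (∣-trans (m%n≡0⇒n∣m d 2 d-even) d∣t))) t-odd) 0≢1+n

module Cyclic (n : ℕ) .{{_ : NonZero n}} where

  -- Arithmetic modulo n

  infix 4 _≋_
  _≋_ : ℕ → ℕ → Set
  _≋_ = _≡_ on (_% n)

  ≋-setoid : Setoid _ _
  ≋-setoid = On.setoid (setoid ℕ) (_% n)

  open Setoid ≋-setoid using () renaming (refl to ≋-refl; sym to ≋-sym; trans to ≋-trans)

  ≡⇒≋ : ∀ {x y} → x ≡ y → x ≋ y
  ≡⇒≋ = cong (_% n)

  %-≋ : ∀ x → x % n ≋ x
  %-≋ x = m%n%n≡m%n x n

  n≋0 : n ≋ 0
  n≋0 = trans (n%n≡0 n) (sym (m<n⇒m%n≡m (>-nonZero⁻¹ n)))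

  +-≋ : ∀ {x y u v} → x ≋ y → u ≋ v → x + u ≋ y + v
  +-≋ {x} {y} {u} {v} x≋y u≋v = begin
    (x + u) % n             ≡⟨ %-distribˡ-+ x u n ⟩
    (x % n + u % n) % n     ≡⟨ cong₂ (λ a b → (a + b) % n) x≋y u≋v ⟩
    (y % n + v % n) % n     ≡⟨ %-distribˡ-+ y v n ⟨
    (y + v) % n             ∎
    where open ≡-Reasoning

  -- the additive inverse, written in the form in which rot, flip and reflect subtract
  -_ : ℕ → ℕ
  - x = n ∸ x % n

  -‿inverseˡ : ∀ x → - x + x ≋ 0
  -‿inverseˡ x = begin
    - x + x           ≈⟨ +-≋ {x = - x} ≋-refl (≋-sym (%-≋ x)) ⟩
    - x + x % n       ≡⟨ m∸n+n≡m (m%n≤n x n) ⟩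
    n                 ≈⟨ n≋0 ⟩
    0                 ∎
    where open ≈-Reasoning ≋-setoid

  x+-y+y≋x : ∀ x y → x + - y + y ≋ x
  x+-y+y≋x x y = begin
    x + - y + y       ≡⟨ +-assoc x (- y) y ⟩
    x + (- y + y)     ≈⟨ +-≋ {x = x} ≋-refl (-‿inverseˡ y) ⟩
    x + 0             ≡⟨ +-identityʳ x ⟩
    x                 ∎
    where open ≈-Reasoning ≋-setoid

  x+y+-y≋x : ∀ x y → x + y + - y ≋ x
  x+y+-y≋x x y = ≋-trans (≡⇒≋ (xy∙z≈xz∙y x y (- y))) (x+-y+y≋x x y)

  +-cancelʳ-≋ : ∀ {x y} z → x + z ≋ y + z → x ≋ y
  +-cancelʳ-≋ {x} {y} z x+z≋y+z = begin
    x                 ≈⟨ x+y+-y≋x x z ⟨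
    x + z + - z       ≈⟨ +-≋ x+z≋y+z ≋-refl ⟩
    y + z + - z       ≈⟨ x+y+-y≋x y z ⟩
    y                 ∎
    where open ≈-Reasoning ≋-setoid

  x+y≋z⇒y≋z+-x : ∀ {x y z} → x + y ≋ z → y ≋ z + - x
  x+y≋z⇒y≋z+-x {x} {y} {z} x+y≋z = +-cancelʳ-≋ x (begin
    y + x             ≡⟨ +-comm y x ⟩
    x + y             ≈⟨ x+y≋z ⟩
    z                 ≈⟨ x+-y+y≋x z x ⟨
    z + - x + x       ∎)
    where open ≈-Reasoning ≋-setoid

  x+-[y+z]+z≋x+-y : ∀ x y z → x + - (y + z) + z ≋ x + - y
  x+-[y+z]+z≋x+-y x y z = +-cancelʳ-≋ y (begin
    x + - (y + z) + z + y      ≡⟨ xy∙z≈x∙zy (x + - (y + z)) z y ⟩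
    x + - (y + z) + (y + z)    ≈⟨ x+-y+y≋x x (y + z) ⟩
    x                          ≈⟨ x+-y+y≋x x y ⟨
    x + - y + y                ∎)
    where open ≈-Reasoning ≋-setoid

  toℕ-idx : ∀ x → toℕ (idx n x) ≡ x % n
  toℕ-idx x = toℕ-fromℕ< (m%n<n x n)

  toℕ-idx-≋ : ∀ x → toℕ (idx n x) ≋ x
  toℕ-idx-≋ x = trans (cong (_% n) (toℕ-idx x)) (%-≋ x)

  idx-toℕ : ∀ i → idx n (toℕ i) ≡ i
  idx-toℕ i = toℕ-injective (trans (toℕ-idx (toℕ i)) (m<n⇒m%n≡m (toℕ<n i)))

  idx-cong : ∀ {x y} → x ≋ y → idx n x ≡ idx n y
  idx-cong {x} {y} x≋y = toℕ-injective (trans (toℕ-idx x) (trans x≋y (sym (toℕ-idx y))))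

  -- Colourings as n-periodic functions

  colourAt : Coloring n → ℕ → Bool
  colourAt l x = lookup l (idx n x)

  colourAt-cong : ∀ l {x y} → x ≋ y → colourAt l x ≡ colourAt l y
  colourAt-cong l = cong (lookup l) ∘ idx-cong

  colourAt-toℕ : ∀ l i → colourAt l (toℕ i) ≡ lookup l i
  colourAt-toℕ l i = cong (lookup l) (idx-toℕ i)

  colourAt-ext : ∀ {l l′} → (∀ x → colourAt l x ≡ colourAt l′ x) → l ≡ l′
  colourAt-ext {l} {l′} same = Pointwise-≡⇒≡ (ext λ i →
    trans (sym (colourAt-toℕ l i)) (trans (same (toℕ i)) (colourAt-toℕ l′ i)))

  colourAt-rot : ∀ l r x → colourAt (rot r l) x ≡ colourAt l (x + - r)
  colourAt-rot l r x = trans (lookup∘tabulate _ (idx n x)) (colourAt-cong l (+-≋ (toℕ-idx-≋ x) ≋-refl))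

  colourAt-rot-+ : ∀ l r x → colourAt (rot r l) (x + r) ≡ colourAt l x
  colourAt-rot-+ l r x = trans (colourAt-rot l r (x + r)) (colourAt-cong l (x+y+-y≋x x r))

  colourAt-flip : ∀ l x → colourAt (flip l) x ≡ colourAt l (- x)
  colourAt-flip l x = trans (lookup∘tabulate _ (idx n x)) (cong (λ y → colourAt l (n ∸ y)) (toℕ-idx x))

  colourAt-reflect : ∀ k l x → colourAt (reflect k l) x ≡ colourAt l (toℕ k + - x)
  colourAt-reflect k l x =
    trans (lookup∘tabulate _ (idx n x)) (cong (λ y → colourAt l (toℕ k + (n ∸ y))) (toℕ-idx x))

  rot-≋0 : ∀ l {r} → r ≋ 0 → rot r l ≡ l
  rot-≋0 l {r} r≋0 = colourAt-ext λ x → trans (colourAt-rot l r x) (colourAt-cong l (begin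
    x + - r           ≡⟨ +-identityʳ (x + - r) ⟨
    x + - r + 0       ≈⟨ +-≋ {x = x + - r} ≋-refl r≋0 ⟨
    x + - r + r       ≈⟨ x+-y+y≋x x r ⟩
    x                 ∎))
    where open ≈-Reasoning ≋-setoid

  sameOrbit-refl : ∀ l → SameOrbit l l
  sameOrbit-refl l = idx n 0 , rot-≋0 l (toℕ-idx-≋ 0)

  -- Periods and the orbit size

  Periodic : Coloring n → ℕ → Set
  Periodic l p = ∀ x → colourAt l (x + p) ≡ colourAt l x

  HasOddPeriod : Coloring n → Set
  HasOddPeriod l = ∃ λ t → t % 2 ≡ 1 × Periodic l t

  periodic-≋0 : ∀ l {p} → p ≋ 0 → Periodic l p
  periodic-≋0 l {p} p≋0 x = colourAt-cong l (≋-trans (+-≋ {x = x} ≋-refl p≋0) (≡⇒≋ (+-identityʳ x)))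

  periodic-+ : ∀ l {p q} → Periodic l p → Periodic l q → Periodic l (p + q)
  periodic-+ l {p} {q} per-p per-q x =
    trans (cong (colourAt l) (sym (+-assoc x p q))) (trans (per-q (x + p)) (per-p x))

  periodic-* : ∀ l {p} → Periodic l p → ∀ k → Periodic l (k * p)
  periodic-* l per zero    = periodic-≋0 l ≋-refl
  periodic-* l per (suc k) = periodic-+ l per (periodic-* l per k)

  periodic-+⁻ˡ : ∀ l {p q} → Periodic l (p + q) → Periodic l q → Periodic l p
  periodic-+⁻ˡ l {p} {q} per-pq per-q x =
    trans (sym (per-q (x + p))) (trans (cong (colourAt l) (+-assoc x p q)) (per-pq x))

  periodic? : ∀ l → Decidable (Periodic l)
  periodic? l p with all? (λ i → colourAt l (toℕ i + p) Bool.≟ colourAt l (toℕ i))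
  ... | yes per = yes λ x → trans (colourAt-cong l (+-≋ (≋-sym (toℕ-idx-≋ x)) ≋-refl))
                              (trans (per (idx n x)) (colourAt-cong l (toℕ-idx-≋ x)))
  ... | no ¬per = no λ per → ¬per (per ∘ toℕ)

  rot-+≡rot⇔periodic : ∀ l r p → rot (r + p) l ≡ rot r l ⇔ Periodic l p
  rot-+≡rot⇔periodic l r p = mk⇔ shift⇒periodic periodic⇒shift
    where
      open ≡-Reasoning
      shift⇒periodic : rot (r + p) l ≡ rot r l → Periodic l p
      shift⇒periodic same y = begin
        colourAt l (y + p)                       ≡⟨ colourAt-rot-+ l r (y + p) ⟨
        colourAt (rot r l) (y + p + r)           ≡⟨ cong (colourAt (rot r l)) (xy∙z≈x∙zy y p r) ⟩
        colourAt (rot r l) (y + (r + p))         ≡⟨ cong (λ l′ → colourAt l′ (y + (r + p))) same ⟨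
        colourAt (rot (r + p) l) (y + (r + p))   ≡⟨ colourAt-rot-+ l (r + p) y ⟩
        colourAt l y                             ∎
      periodic⇒shift : Periodic l p → rot (r + p) l ≡ rot r l
      periodic⇒shift per = colourAt-ext λ x → begin
        colourAt (rot (r + p) l) x               ≡⟨ colourAt-rot l (r + p) x ⟩
        colourAt l (x + - (r + p))               ≡⟨ per (x + - (r + p)) ⟨
        colourAt l (x + - (r + p) + p)           ≡⟨ colourAt-cong l (x+-[y+z]+z≋x+-y x r p) ⟩
        colourAt l (x + - r)                     ≡⟨ colourAt-rot l r x ⟨
        colourAt (rot r l) x                     ∎

  private
    leastPeriod : ∀ l → ∃ λ m → Periodic l (suc m) × (∀ {k} → k < m → ¬ Periodic l (suc k))
    leastPeriod l = least-witness (periodic? l ∘ suc) (pred n)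
      (subst (Periodic l) (sym (suc-pred n)) (periodic-≋0 l n≋0))

  minimalPeriod : Coloring n → ℕ
  minimalPeriod l = suc (proj₁ (leastPeriod l))

  minimalPeriod-periodic : ∀ l → Periodic l (minimalPeriod l)
  minimalPeriod-periodic l = proj₁ (proj₂ (leastPeriod l))

  minimalPeriod-minimal : ∀ l {p} → 0 < p → p < minimalPeriod l → ¬ Periodic l p
  minimalPeriod-minimal l {suc k} _ (s<s k<m) = proj₂ (proj₂ (leastPeriod l)) k<m

  minimalPeriod≤n : ∀ l → minimalPeriod l ≤ n
  minimalPeriod≤n l = ≮⇒≥ λ n<d → minimalPeriod-minimal l (>-nonZero⁻¹ n) n<d (periodic-≋0 l n≋0)

  periodic-%minimalPeriod : ∀ l p → Periodic l p → Periodic l (p % minimalPeriod l)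
  periodic-%minimalPeriod l p per = periodic-+⁻ˡ l
    (subst (Periodic l) (m≡m%n+[m/n]*n p d) per) (periodic-* l (minimalPeriod-periodic l) (p / d))
    where d = minimalPeriod l

  minimalPeriod-∣ : ∀ l {p} → Periodic l p → minimalPeriod l ∣ p
  minimalPeriod-∣ l {p} per = m%n≡0⇒n∣m p d (n≤0⇒n≡0 (≮⇒≥ λ 0<p%d →
    minimalPeriod-minimal l 0<p%d (m%n<n p d) (periodic-%minimalPeriod l p per)))
    where d = minimalPeriod l

  rot≡rot-%minimalPeriod : ∀ l r → rot r l ≡ rot (r % minimalPeriod l) l
  rot≡rot-%minimalPeriod l r = trans (cong (λ s → rot s l) (m≡m%n+[m/n]*n r d))
    (from (rot-+≡rot⇔periodic l (r % d) (r / d * d)) (periodic-* l (minimalPeriod-periodic l) (r / d)))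
    where d = minimalPeriod l

  rot≢rot-below-minimalPeriod : ∀ l {i j} → i < j → j < minimalPeriod l → rot i l ≢ rot j l
  rot≢rot-below-minimalPeriod l {i} {j} i<j j<d roti≡rotj = minimalPeriod-minimal l
    (m<n⇒0<n∸m i<j) (≤-<-trans (m∸n≤m j i) j<d)
    (to (rot-+≡rot⇔periodic l i (j ∸ i))
      (trans (cong (λ s → rot s l) (m+[n∸m]≡n (<⇒≤ i<j))) (sym roti≡rotj)))

  rotations : ℕ → Coloring n → List (Coloring n)
  rotations m l = List.tabulate {n = m} (λ i → rot (toℕ i) l)

  rot∈rotations : ∀ {m} l {r} → r < m → rot r l ∈ rotations m l
  rot∈rotations l {r} r<m = subst (λ s → rot s l ∈ rotations _ l) (toℕ-fromℕ< r<m) (∈-tabulate⁺ (fromℕ< r<m))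

  orbitSize≡minimalPeriod : ∀ l → orbitSize l ≡ minimalPeriod l
  orbitSize≡minimalPeriod l = begin
    orbitSize l
      ≡⟨ cong (length ∘ deduplicate _≟ᶜ_) (toList-tabulate {m = n} rotation) ⟩
    length (deduplicate _≟ᶜ_ (rotations n l))
      ≡⟨ length-deduplicate _≟ᶜ_ (tabulate⁺ rotation-injective) same-members ⟩
    length (rotations d l)
      ≡⟨ length-tabulate rotation ⟩
    d ∎
    where
      open ≡-Reasoning
      d = minimalPeriod l

      _≟ᶜ_ : DecidableEquality (Coloring n)
      _≟ᶜ_ = ≡-dec Bool._≟_

      rotation : ∀ {m} → Fin m → Coloring n
      rotation i = rot (toℕ i) l

      rotation-injective : ∀ {i j : Fin d} → rotation i ≡ rotation j → i ≡ j
      rotation-injective {i} {j} same with <-cmp (toℕ i) (toℕ j)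
      ... | tri< i<j _ _ = contradiction same (rot≢rot-below-minimalPeriod l i<j (toℕ<n j))
      ... | tri≈ _ i≡j _ = toℕ-injective i≡j
      ... | tri> _ _ j<i = contradiction (sym same) (rot≢rot-below-minimalPeriod l j<i (toℕ<n i))

      reduce : ∀ {x} → x ∈ rotations n l → x ∈ rotations d l
      reduce x∈ with r , refl ← ∈-tabulate⁻ {f = rotation} x∈ =
        subst (_∈ rotations d l) (sym (rot≡rot-%minimalPeriod l (toℕ r))) (rot∈rotations l (m%n<n (toℕ r) d))

      extend : ∀ {x} → x ∈ rotations d l → x ∈ rotations n l
      extend x∈ with i , refl ← ∈-tabulate⁻ {f = rotation} x∈ =
        rot∈rotations l (<-≤-trans (toℕ<n i) (minimalPeriod≤n l))

      same-members : ∀ {x} → x ∈ rotations n l ⇔ x ∈ rotations d l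
      same-members = mk⇔ reduce extend

  oddOrbit⇔hasOddPeriod : ∀ l → OddOrbit l ⇔ HasOddPeriod l
  oddOrbit⇔hasOddPeriod l = mk⇔
    (λ odd → minimalPeriod l , trans (cong (_% 2) (sym (orbitSize≡minimalPeriod l))) odd , minimalPeriod-periodic l)
    (λ (t , t-odd , per) →
      trans (cong (_% 2) (orbitSize≡minimalPeriod l)) (∣odd⇒odd (minimalPeriod-∣ l per) t-odd))

  -- Reflection symmetries

  ReflectionInvariant : Coloring n → ℕ → Set
  ReflectionInvariant l k = ∀ a b → a + b ≋ k → colourAt l a ≡ colourAt l b

  HasSymmetryOfParity : Coloring n → ℕ → Set
  HasSymmetryOfParity l e = ∃ λ k → k % 2 ≡ e × ReflectionInvariant l k

  isSymAxis⇒invariant : ∀ {k l} → IsSymAxis k l → ReflectionInvariant l (toℕ k)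
  isSymAxis⇒invariant {k} {l} symmetric a b a+b≋k = begin
    colourAt l a                 ≡⟨ cong (λ l′ → colourAt l′ a) symmetric ⟨
    colourAt (reflect k l) a     ≡⟨ colourAt-reflect k l a ⟩
    colourAt l (toℕ k + - a)     ≡⟨ colourAt-cong l (x+y≋z⇒y≋z+-x a+b≋k) ⟨
    colourAt l b                 ∎
    where open ≡-Reasoning

  invariant⇒isSymAxis : ∀ {k l} → ReflectionInvariant l k → IsSymAxis (idx n k) l
  invariant⇒isSymAxis {k} {l} invariant = colourAt-ext λ x →
    trans (colourAt-reflect (idx n k) l x)
          (invariant _ x (≋-trans (x+-y+y≋x (toℕ (idx n k)) x) (toℕ-idx-≋ k)))

  invariant-rot : ∀ l r {k k′} → k + (r + r) ≋ k′ → ReflectionInvariant (rot r l) k′ → ReflectionInvariant l k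
  invariant-rot l r {k} {k′} k+2r≋k′ invariant a b a+b≋k = begin
    colourAt l a                 ≡⟨ colourAt-rot-+ l r a ⟨
    colourAt (rot r l) (a + r)   ≡⟨ invariant (a + r) (b + r) a+r+[b+r]≋k′ ⟩
    colourAt (rot r l) (b + r)   ≡⟨ colourAt-rot-+ l r b ⟩
    colourAt l b                 ∎
    where
      open ≡-Reasoning
      a+r+[b+r]≋k′ : a + r + (b + r) ≋ k′
      a+r+[b+r]≋k′ = ≋-trans (≡⇒≋ (interchange a r b r)) (≋-trans (+-≋ a+b≋k ≋-refl) k+2r≋k′)

  invariant-flip : ∀ l {r} → rot r l ≡ flip l → ReflectionInvariant l (- r)
  invariant-flip l {r} rot≡flip a b a+b≋-r = begin
    colourAt l a                 ≡⟨ colourAt-rot-+ l r a ⟨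
    colourAt (rot r l) (a + r)   ≡⟨ cong (λ l′ → colourAt l′ (a + r)) rot≡flip ⟩
    colourAt (flip l) (a + r)    ≡⟨ colourAt-flip l (a + r) ⟩
    colourAt l (- (a + r))       ≡⟨ colourAt-cong l (x+y≋z⇒y≋z+-x a+r+b≋0) ⟨
    colourAt l b                 ∎
    where
      open ≡-Reasoning
      a+r+b≋0 : a + r + b ≋ 0
      a+r+b≋0 = ≋-trans (≡⇒≋ (xy∙z≈xz∙y a r b)) (≋-trans (+-≋ a+b≋-r ≋-refl) (-‿inverseˡ r))

  invariant-periodic : ∀ l {k t} → ReflectionInvariant l k → Periodic l t → ReflectionInvariant l (k + t)
  invariant-periodic l {k} {t} invariant per a b a+b≋k+t = begin
    colourAt l a                 ≡⟨ invariant a b′ (+-cancelʳ-≋ t a+b′+t≋k+t) ⟩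
    colourAt l b′                ≡⟨ per b′ ⟨
    colourAt l (b′ + t)          ≡⟨ colourAt-cong l (x+-y+y≋x b t) ⟩
    colourAt l b                 ∎
    where
      open ≡-Reasoning
      b′ = b + - t
      a+b′+t≋k+t : a + b′ + t ≋ k + t
      a+b′+t≋k+t = ≋-trans (≡⇒≋ (+-assoc a b′ t)) (≋-trans (+-≋ {x = a} ≋-refl (x+-y+y≋x b t)) a+b≋k+t)

  invariants⇒periodic : ∀ l {k₁ k₂ t} → ReflectionInvariant l k₁ → ReflectionInvariant l k₂ →
    t + k₂ ≋ k₁ → Periodic l t
  invariants⇒periodic l {k₁} {k₂} {t} invariant₁ invariant₂ t+k₂≋k₁ x = begin
    colourAt l (x + t)           ≡⟨ invariant₁ (x + t) c x+t+c≋k₁ ⟩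
    colourAt l c                 ≡⟨ invariant₂ x c x+c≋k₂ ⟨
    colourAt l x                 ∎
    where
      open ≡-Reasoning
      c = k₂ + - x
      x+c≋k₂ : x + c ≋ k₂
      x+c≋k₂ = ≋-trans (≡⇒≋ (+-comm x c)) (x+-y+y≋x k₂ x)
      x+t+c≋k₁ : x + t + c ≋ k₁
      x+t+c≋k₁ = ≋-trans (≡⇒≋ (xy∙z≈y∙xz x t c)) (≋-trans (+-≋ {x = t} ≋-refl x+c≋k₂) t+k₂≋k₁)

  invariant∧oddPeriod⇒bothParities : ∀ l {c} → ReflectionInvariant l c → HasOddPeriod l →
    HasSymmetryOfParity l 1 × HasSymmetryOfParity l 0
  invariant∧oddPeriod⇒bothParities l {c} invariant (t , t-odd , per) with %2-dichotomy c
  ... | inj₁ c-even = (c + t , trans (%-remove-+ˡ t (m%n≡0⇒n∣m c 2 c-even)) t-odd ,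
                              invariant-periodic l invariant per)
                    , (c , c-even , invariant)
  ... | inj₂ c-odd  = (c , c-odd , invariant)
                    , (c + t , odd+odd%2≡0 c t c-odd t-odd , invariant-periodic l invariant per)

  -- Axis types

  onAxis⇒≋double : ∀ {k m} → OnAxis k m → toℕ k ≋ toℕ m + toℕ m
  onAxis⇒≋double {k} {m} onAxis = begin
    K                         ≈⟨ [m+n]%n≡m%n K n ⟨
    K + n                     ≡⟨ cong (K +_) (m∸n+n≡m (<⇒≤ (toℕ<n m))) ⟨
    K + ((n ∸ M) + M)         ≡⟨ +-assoc K (n ∸ M) M ⟨
    K + (n ∸ M) + M           ≈⟨ +-≋ (≋-trans (≋-sym (toℕ-idx-≋ _)) (≡⇒≋ (cong toℕ onAxis))) ≋-refl ⟩
    M + M                     ∎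
    where
      open ≈-Reasoning ≋-setoid
      K = toℕ k
      M = toℕ m

  axisType2⇔≋double : ∀ {k} → AxisType2 k ⇔ ∃ λ h → toℕ k ≋ h + h
  axisType2⇔≋double {k} = mk⇔
    (λ (m , onAxis) → toℕ m , onAxis⇒≋double onAxis)
    (λ (h , k≋h+h) → idx n h , idx-cong (begin
      toℕ k + (n ∸ toℕ (idx n h))    ≡⟨ cong (λ y → toℕ k + (n ∸ y)) (toℕ-idx h) ⟩
      toℕ k + - h                    ≈⟨ +-≋ k≋h+h ≋-refl ⟩
      h + h + - h                    ≈⟨ x+y+-y≋x h h ⟩
      h                              ∎))
    where open ≈-Reasoning ≋-setoid

  module Even (2∣n : 2 ∣ n) where

    ≋⇒%2≡ : ∀ {x y} → x ≋ y → x % 2 ≡ y % 2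
    ≋⇒%2≡ {x} {y} x≋y = begin
      x % 2            ≡⟨ m∣n⇒o%n%m≡o%m 2 n x 2∣n ⟨
      x % n % 2        ≡⟨ cong (_% 2) x≋y ⟩
      y % n % 2        ≡⟨ m∣n⇒o%n%m≡o%m 2 n y 2∣n ⟩
      y % 2            ∎
      where open ≡-Reasoning

    [x+-y]%2≡x%2 : ∀ x y → y % 2 ≡ 0 → (x + - y) % 2 ≡ x % 2
    [x+-y]%2≡x%2 x y y-even = trans (sym (%-remove-+ʳ (x + - y) (m%n≡0⇒n∣m y 2 y-even))) (≋⇒%2≡ (x+-y+y≋x x y))

    ≋double⇔even : ∀ {k} → (∃ λ h → k ≋ h + h) ⇔ k % 2 ≡ 0
    ≋double⇔even {k} = mk⇔
      (λ (h , k≋h+h) → trans (≋⇒%2≡ k≋h+h) ([m+m]%2≡0 h))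
      (λ even → k / 2 , ≡⇒≋ (trans (m≡m%n+[m/n]*n k 2) (cong₂ _+_ even (m*2≡m+m (k / 2)))))

    axisType2⇔even : ∀ {k} → AxisType2 k ⇔ toℕ k % 2 ≡ 0
    axisType2⇔even = ⇔-trans axisType2⇔≋double ≋double⇔even

    axisType1⇔odd : ∀ {k} → AxisType1 k ⇔ toℕ k % 2 ≡ 1
    axisType1⇔odd {k} = mk⇔ type1⇒odd λ odd type2 → 0≢1+n (trans (sym (to axisType2⇔even type2)) odd)
      where
        type1⇒odd : AxisType1 k → toℕ k % 2 ≡ 1
        type1⇒odd ¬type2 with %2-dichotomy (toℕ k)
        ... | inj₁ even = contradiction (from axisType2⇔even even) ¬type2
        ... | inj₂ odd  = odd

    symmetryOfRepresentative : ∀ l {l′ k} → SameOrbit l l′ → IsSymAxis k l′ → HasSymmetryOfParity l (toℕ k % 2)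
    symmetryOfRepresentative l {k = k} (r , refl) symmetric =
      toℕ k + - R , [x+-y]%2≡x%2 (toℕ k) R ([m+m]%2≡0 (toℕ r)) ,
      invariant-rot l (toℕ r) (x+-y+y≋x (toℕ k) R) (isSymAxis⇒invariant symmetric)
      where R = toℕ r + toℕ r

    hasRepWithAxis⇔hasSymmetryOfParity : ∀ {e} (AxisType : Fin n → Set) → (∀ {k} → AxisType k ⇔ toℕ k % 2 ≡ e) →
      ∀ l → (∃ λ l′ → SameOrbit l l′ × ∃ λ k → IsSymAxis k l′ × AxisType k) ⇔ HasSymmetryOfParity l e
    hasRepWithAxis⇔hasSymmetryOfParity AxisType axisType⇔parity l = mk⇔
      (λ (_ , same , k , symmetric , type) → subst (HasSymmetryOfParity l) (to axisType⇔parity type)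
        (symmetryOfRepresentative l same symmetric))
      (λ (K , K-parity , invariant) → l , sameOrbit-refl l , idx n K , invariant⇒isSymAxis invariant ,
        from axisType⇔parity (trans (≋⇒%2≡ (toℕ-idx-≋ K)) K-parity))

    hasRepWithAxis1⇔hasSymmetryOfParity1 : ∀ l → HasRepWithAxis1 l ⇔ HasSymmetryOfParity l 1
    hasRepWithAxis1⇔hasSymmetryOfParity1 = hasRepWithAxis⇔hasSymmetryOfParity AxisType1 axisType1⇔odd

    hasRepWithAxis2⇔hasSymmetryOfParity0 : ∀ l → HasRepWithAxis2 l ⇔ HasSymmetryOfParity l 0
    hasRepWithAxis2⇔hasSymmetryOfParity0 = hasRepWithAxis⇔hasSymmetryOfParity AxisType2 axisType2⇔even

    bothParities⇒hasOddPeriod : ∀ l → HasSymmetryOfParity l 1 → HasSymmetryOfParity l 0 → HasOddPeriod l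
    bothParities⇒hasOddPeriod l (k₁ , k₁-odd , invariant₁) (k₂ , k₂-even , invariant₂) =
      k₁ + - k₂ , trans ([x+-y]%2≡x%2 k₁ k₂ k₂-even) k₁-odd ,
      invariants⇒periodic l invariant₁ invariant₂ (x+-y+y≋x k₁ k₂)

lemma3p14 : (n : ℕ) → .{{_ : NonZero n}} → 2 ≤ n → n % 2 ≡ 0 →
    (j : ℕ) → j ≤ n → (l : Coloring n) → InNeck j l →
    ((FlipFixedOrbit l × HasRepWithAxis1 l × HasRepWithAxis2 l)
      ⇔ (FlipFixedOrbit l × OddOrbit l))
lemma3p14 n _ n-even _ _ l _ = mk⇔
  (λ (flipFixed , rep₁ , rep₂) → flipFixed , from (oddOrbit⇔hasOddPeriod l)
    (bothParities⇒hasOddPeriod l (to (hasRepWithAxis1⇔hasSymmetryOfParity1 l) rep₁)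
                                 (to (hasRepWithAxis2⇔hasSymmetryOfParity0 l) rep₂)))
  (λ ((r , rot≡flip) , odd) → (r , rot≡flip) ,
    Product.map (from (hasRepWithAxis1⇔hasSymmetryOfParity1 l)) (from (hasRepWithAxis2⇔hasSymmetryOfParity0 l))
      (invariant∧oddPeriod⇒bothParities l (invariant-flip l rot≡flip) (to (oddOrbit⇔hasOddPeriod l) odd)))
  where
    open Cyclic n
    open Even (m%n≡0⇒n∣m n 2 n-even)
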